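{- For every integer $k\ge 1$, \[f(k+1) = 2^{2^k} + \left(2^{2^k-1}-1 - eq(2^{k}-1)\right)f(k) = 2^{2^k} + \left(2^{2^k-1} -1- \tfrac{1}{3}(2^{2^k-1}-2)\right)f(k).\]
   Context: $\mu$ is the morphism on binary words with $\mu(0)=01$, $\mu(1)=10$; $\mu^n$ is its $n$-fold iterate. The Thue–Morse sequence $\mathbf{t}=t_0t_1\cdots$ has $t_i$ equal to the parity of the number of $1$'s in the binary expansion of $i$, and $eq(n)=|\{i: 0\le i<2^n-1,\ t_i=t_{i+1}\}|$. Words $CS(k)$, $k\ge 0$, are defined recursively: $CS(0)=0$ (the one-letter word). For $k\ge 1$, let $n=2^k$, $m=2^{k-1}$, $X=\mu^n(0)$, $Y=\mu^n(1)$, and write $X=x_0x_1\cdots x_{2^m-1}$, $Y=y_0y_1\cdots y_{2^m-1}$ as concatenations of $2^m$ consecutive blocks of length $2^m$ (each block is $\mu^m(0)$ or $\mu^m(1)$). For $0\le i<2^m-1$ define $cs_i=x_i$ if $i$ is even; if $i$ is odd, $cs_i=x_i$ when $x_i=y_{i+1}$ and $cs_i=CS(k-1)$ otherwise. Then $CS(k)=cs_0cs_1\cdots cs_{2^m-2}$. Define $f(k)=2^{2^k}-|CS(k)|$. -}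

module Defs where

open import Data.Bool using (Bool; true; false; not; if_then_else_; _xor_)
open import Data.Nat using (ℕ; zero; suc; _+_; _*_; _∸_; _^_; _≡ᵇ_)
open import Data.Nat.DivMod using (_/_; _%_)
open import Data.List using (List; []; _∷_; _++_; map; concat; concatMap; take; drop; length; upTo; filter; head)
open import Data.Maybe using (Maybe; just; nothing)
open import Data.Integer using (ℤ; +_; _-_)
open import Relation.Nullary.Decidable using (yes; no; does)
open import Data.List.Properties using (≡-dec)
open import Data.Bool.Properties using () renaming (_≟_ to _≟ᵇ_)

-- Binary words: false = 0, true = 1.
Word : Set
Word = List Bool

μ : Word → Word
μ [] = []
μ (b ∷ w) = b ∷ not b ∷ μ w

μ^ : ℕ → Word → Word
μ^ zero w = w
μ^ (suc n) w = μ (μ^ n w)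

-- parity of the number of 1's in the binary expansion of i (fuel ≥ i suffices)
parityOnes : ℕ → ℕ → Bool
parityOnes zero i = false
parityOnes (suc fuel) i = (i % 2 ≡ᵇ 1) xor parityOnes fuel (i / 2)

t : ℕ → Bool
t i = parityOnes i i

eq : ℕ → ℕ
eq n = length (filter (λ i → t i ≟ᵇ t (suc i)) (upTo (2 ^ n ∸ 1)))

block : ℕ → ℕ → Word → Word
block ℓ i w = take ℓ (drop (i * ℓ) w)

CS : ℕ → Word
CS zero = false ∷ []
CS (suc k) = concatMap cs (upTo (2 ^ m ∸ 1))
  where
  m : ℕ
  m = 2 ^ k
  n : ℕ
  n = 2 ^ suc k
  X : Word
  X = μ^ n (false ∷ [])
  Y : Word
  Y = μ^ n (true ∷ [])
  x : ℕ → Word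
  x i = block (2 ^ m) i X
  y : ℕ → Word
  y i = block (2 ^ m) i Y
  eqW : Word → Word → Bool
  eqW u v = does (≡-dec _≟ᵇ_ u v)
  cs : ℕ → Word
  cs i = if i % 2 ≡ᵇ 0 then x i else (if eqW (x i) (y (suc i)) then x i else CS k)

f : ℕ → ℤ
f k = + (2 ^ (2 ^ k)) - + length (CS k)

module Submission where

-- Write m = 2^k, L = 2^m and J = 2^{m-1} - 1, so that L = 2(J+1).  The Thue–Morse
-- word μⁿ(b) is the prefix of length 2ⁿ of t (complemented if b = 1), and μ^{2^{k+1}} = μ^m ∘ μ^m,
-- so the i-th block of length L of X = μ^{2^{k+1}}(0) is μ^m(t_i) and that of Y is μ^m(¬t_i).
-- CS(k+1) is made of the 2J+1 words cs_i, i < L - 1: the J+1 even ones are full blocks, and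
-- cs_{2j+1} is a full block when x_{2j+1} = y_{2j+2}, i.e. (by t_{2j+1} = ¬t_j, t_{2j+2} = t_{j+1})
-- exactly when t_j = t_{j+1}, and a copy of CS(k) otherwise.  Counting these cases gives
--   |CS(k+1)| = (2J+1)·L - (J - eq(m-1))·(L - |CS(k)|),
-- which rearranges to the integer recurrence for f.  For the second form we show
-- eq(n+1) + eq(n) + 1 = 2ⁿ (adjacent equal pairs of t at odd positions mirror unequal pairs of
-- t₀⋯t_n), which forces 3·eq(n) + 2 = 2ⁿ for odd n, in particular for n = 2^k - 1 when k ≥ 1;
-- the rational identity then follows through the ring embedding ℤ → ℚ.

open import Defs
open import Data.Nat using (ℕ; zero; suc; _≥_; _^_; _∸_)
open import Data.Bool using (Bool; true; false; not; _xor_; if_then_else_)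
open import Data.Bool.Properties using () renaming (_≟_ to _≟ᵇ_)
open import Data.List using (List; []; _∷_; _++_; [_]; concatMap; take; drop; length; upTo; filter)
open import Data.List.Properties using (≡-dec; upTo-∷ʳ; concatMap-++; length-++; ++-identityʳ; filter-++)
open import Data.Product using (Σ; _,_)
open import Relation.Nullary.Decidable using (does; yes; no; dec-true; dec-false)
open import Relation.Unary using (Pred; Decidable)
open import Relation.Binary.PropositionalEquality
  using (_≡_; refl; sym; trans; cong; cong₂; subst; module ≡-Reasoning)

module ThueMorseSequence where
  open import Data.Nat
  open import Data.Nat.Properties using (≤-refl; ≤-trans; n≤1+n; <⇒≤pred)
  open import Data.Nat.DivMod using (m/n<m; m/n≤m; m*n/n≡m; m*n%n≡0; [m+kn]%n≡m%n; +-distrib-/-∣ʳ)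
  open import Data.Nat.Divisibility using (n∣m*n)
  open ≡-Reasoning

  parityOnes-of-zero : ∀ fuel → parityOnes fuel 0 ≡ false
  parityOnes-of-zero zero = refl
  parityOnes-of-zero (suc fuel) = parityOnes-of-zero fuel

  half-≤ : ∀ i a → i ≤ suc a → i / 2 ≤ a
  half-≤ zero a _ = z≤n
  half-≤ (suc j) a (s≤s j≤a) = ≤-trans (<⇒≤pred (m/n<m (suc j) 2 (s≤s (s≤s z≤n)))) j≤a

  parityOnes-fuel : ∀ a b i → i ≤ a → i ≤ b → parityOnes a i ≡ parityOnes b i
  parityOnes-fuel zero b zero _ _ = sym (parityOnes-of-zero b)
  parityOnes-fuel (suc a) zero zero _ _ = parityOnes-of-zero (suc a)
  parityOnes-fuel (suc a) (suc b) i i≤a i≤b =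
    cong ((i % 2 ≡ᵇ 1) xor_) (parityOnes-fuel a b (i / 2) (half-≤ i a i≤a) (half-≤ i b i≤b))

  t-halving : ∀ i → t i ≡ (i % 2 ≡ᵇ 1) xor t (i / 2)
  t-halving i = begin
      parityOnes i i
    ≡⟨ parityOnes-fuel i (suc i) i ≤-refl (n≤1+n i) ⟩
      (i % 2 ≡ᵇ 1) xor parityOnes i (i / 2)
    ≡⟨ cong ((i % 2 ≡ᵇ 1) xor_) (parityOnes-fuel i (i / 2) (i / 2) (m/n≤m i 2) ≤-refl) ⟩
      (i % 2 ≡ᵇ 1) xor t (i / 2) ∎

  t-even : ∀ j → t (j * 2) ≡ t j
  t-even j = begin
      t (j * 2)
    ≡⟨ t-halving (j * 2) ⟩
      (j * 2 % 2 ≡ᵇ 1) xor t (j * 2 / 2)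
    ≡⟨ cong₂ (λ r q → (r ≡ᵇ 1) xor t q) (m*n%n≡0 j 2) (m*n/n≡m j 2) ⟩
      t j ∎

  odd-mod : ∀ j → suc (j * 2) % 2 ≡ 1
  odd-mod j = [m+kn]%n≡m%n 1 j 2

  odd-div : ∀ j → suc (j * 2) / 2 ≡ j
  odd-div j = trans (+-distrib-/-∣ʳ 1 {d = 2} (n∣m*n j)) (m*n/n≡m j 2)

  t-odd : ∀ j → t (suc (j * 2)) ≡ not (t j)
  t-odd j = begin
      t (suc (j * 2))
    ≡⟨ t-halving (suc (j * 2)) ⟩
      (suc (j * 2) % 2 ≡ᵇ 1) xor t (suc (j * 2) / 2)
    ≡⟨ cong₂ (λ r q → (r ≡ᵇ 1) xor t q) (odd-mod j) (odd-div j) ⟩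
      not (t j) ∎

open ThueMorseSequence using (t-even; t-odd; odd-mod)

-- iterates of μ are prefixes of t, and their blocks are iterates of single letters
module ThueMorseWords where
  open import Data.Nat
  open import Data.Nat.Properties using (*-comm; +-identityʳ; +-suc)
  open ≡-Reasoning

  tmFactor : Bool → ℕ → ℕ → Word
  tmFactor b s zero = []
  tmFactor b s (suc n) = (b xor t s) ∷ tmFactor b (suc s) n

  length-tmFactor : ∀ b s n → length (tmFactor b s n) ≡ n
  length-tmFactor b s zero = refl
  length-tmFactor b s (suc n) = cong suc (length-tmFactor b (suc s) n)

  xor-not : ∀ b x → b xor not x ≡ not (b xor x)
  xor-not false x = refl
  xor-not true x = refl

  -- μ maps the factor at s of length n to the factor at 2s of length 2n, since t_{2i} = t_i, t_{2i+1} = ¬t_i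
  μ-tmFactor : ∀ b s n → μ (tmFactor b s n) ≡ tmFactor b (s * 2) (n * 2)
  μ-tmFactor b s zero = refl
  μ-tmFactor b s (suc n) =
    cong₂ _∷_ (cong (b xor_) (sym (t-even s)))
      (cong₂ _∷_ (trans (sym (xor-not b (t s))) (cong (b xor_) (sym (t-odd s))))
        (μ-tmFactor b (suc s) n))

  xor-false : ∀ b → b xor false ≡ b
  xor-false false = refl
  xor-false true = refl

  μ^-letter : ∀ b n → μ^ n [ b ] ≡ tmFactor b 0 (2 ^ n)
  μ^-letter b zero = cong [_] (sym (xor-false b))
  μ^-letter b (suc n) = begin
      μ (μ^ n [ b ])
    ≡⟨ cong μ (μ^-letter b n) ⟩
      μ (tmFactor b 0 (2 ^ n))
    ≡⟨ μ-tmFactor b 0 (2 ^ n) ⟩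
      tmFactor b 0 (2 ^ n * 2)
    ≡⟨ cong (tmFactor b 0) (*-comm (2 ^ n) 2) ⟩
      tmFactor b 0 (2 ^ suc n) ∎

  length-μ^-letter : ∀ n b → length (μ^ n [ b ]) ≡ 2 ^ n
  length-μ^-letter n b = trans (cong length (μ^-letter b n)) (length-tmFactor b 0 (2 ^ n))

  μ^-head : ∀ n b → Σ Word (λ r → μ^ n [ b ] ≡ b ∷ r)
  μ^-head zero b = [] , refl
  μ^-head (suc n) b with μ^ n [ b ] | μ^-head n b
  ... | _ | r , refl = not b ∷ μ r , refl

  μ^-letter-injective : ∀ n a b → μ^ n [ a ] ≡ μ^ n [ b ] → a ≡ b
  μ^-letter-injective n a b images-equal with μ^-head n a | μ^-head n b
  ... | r , ea | s , eb with trans (sym ea) (trans images-equal eb)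
  ... | refl = refl

  μ-++ : ∀ u v → μ (u ++ v) ≡ μ u ++ μ v
  μ-++ [] v = refl
  μ-++ (c ∷ u) v = cong (λ w → c ∷ not c ∷ w) (μ-++ u v)

  μ^-++ : ∀ n u v → μ^ n (u ++ v) ≡ μ^ n u ++ μ^ n v
  μ^-++ zero u v = refl
  μ^-++ (suc n) u v = trans (cong μ (μ^-++ n u v)) (μ-++ (μ^ n u) (μ^ n v))

  μ^-empty : ∀ n → μ^ n [] ≡ []
  μ^-empty zero = refl
  μ^-empty (suc n) = cong μ (μ^-empty n)

  μ^-letterwise : ∀ n w → μ^ n w ≡ concatMap (λ c → μ^ n [ c ]) w
  μ^-letterwise n [] = μ^-empty n
  μ^-letterwise n (c ∷ w) = trans (μ^-++ n [ c ] w) (cong (μ^ n [ c ] ++_) (μ^-letterwise n w))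

  μ^-+ : ∀ a b w → μ^ (a + b) w ≡ μ^ a (μ^ b w)
  μ^-+ zero b w = refl
  μ^-+ (suc a) b w = cong μ (μ^-+ a b w)

  take-length-++ : ∀ {A : Set} (u v : List A) → take (length u) (u ++ v) ≡ u
  take-length-++ [] v = refl
  take-length-++ (c ∷ u) v = cong (c ∷_) (take-length-++ u v)

  drop-length-++ : ∀ {A : Set} (u v : List A) j → drop (length u + j) (u ++ v) ≡ drop j v
  drop-length-++ [] v j = refl
  drop-length-++ (c ∷ u) v j = drop-length-++ u v j

  block-concatMap : ∀ (g : Bool → Word) L → (∀ c → length (g c) ≡ L) →
    ∀ b s n i → i < n → block L i (concatMap g (tmFactor b s n)) ≡ g (b xor t (s + i))
  block-concatMap g L uniform b s (suc n) zero _ = begin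
      take L (g (b xor t s) ++ rest)
    ≡⟨ cong (λ ℓ → take ℓ (g (b xor t s) ++ rest)) (sym (uniform _)) ⟩
      take (length (g (b xor t s))) (g (b xor t s) ++ rest)
    ≡⟨ take-length-++ (g (b xor t s)) rest ⟩
      g (b xor t s)
    ≡⟨ cong (λ x → g (b xor t x)) (sym (+-identityʳ s)) ⟩
      g (b xor t (s + 0)) ∎
    where rest = concatMap g (tmFactor b (suc s) n)
  block-concatMap g L uniform b s (suc n) (suc i) (s≤s i<n) = begin
      take L (drop (L + i * L) (g (b xor t s) ++ rest))
    ≡⟨ cong (λ ℓ → take L (drop (ℓ + i * L) (g (b xor t s) ++ rest))) (sym (uniform _)) ⟩
      take L (drop (length (g (b xor t s)) + i * L) (g (b xor t s) ++ rest))
    ≡⟨ cong (take L) (drop-length-++ (g (b xor t s)) rest (i * L)) ⟩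
      block L i rest
    ≡⟨ block-concatMap g L uniform b (suc s) n i i<n ⟩
      g (b xor t (suc s + i))
    ≡⟨ cong (λ x → g (b xor t x)) (sym (+-suc s i)) ⟩
      g (b xor t (s + suc i)) ∎
    where rest = concatMap g (tmFactor b (suc s) n)

  block-μ^-μ^ : ∀ a c b i → i < 2 ^ c → block (2 ^ a) i (μ^ a (μ^ c [ b ])) ≡ μ^ a [ b xor t i ]
  block-μ^-μ^ a c b i i<2^c = begin
      block (2 ^ a) i (μ^ a (μ^ c [ b ]))
    ≡⟨ cong (λ w → block (2 ^ a) i (μ^ a w)) (μ^-letter b c) ⟩
      block (2 ^ a) i (μ^ a (tmFactor b 0 (2 ^ c)))
    ≡⟨ cong (block (2 ^ a) i) (μ^-letterwise a (tmFactor b 0 (2 ^ c))) ⟩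
      block (2 ^ a) i (concatMap (λ d → μ^ a [ d ]) (tmFactor b 0 (2 ^ c)))
    ≡⟨ block-concatMap (λ d → μ^ a [ d ]) (2 ^ a) (length-μ^-letter a) b 0 (2 ^ c) i i<2^c ⟩
      μ^ a [ b xor t i ] ∎

open ThueMorseWords using (μ^-+; block-μ^-μ^; length-μ^-letter; μ^-letter-injective)

module BlocksOfCS where
  open import Data.Nat
  open import Data.Nat.Properties using (+-identityʳ; <-trans; n<1+n)
  open import Data.Nat.DivMod using (m*n%n≡0)
  open ≡-Reasoning

  repeatAt : ℕ → Bool
  repeatAt j = does (t j ≟ᵇ t (suc j))

  wordEq : Word → Word → Bool
  wordEq u v = does (≡-dec _≟ᵇ_ u v)

  -- the i-th block, of length 2^{2^k}, of X = μ^{2^{k+1}}(0) (b = 0) or Y = μ^{2^{k+1}}(1) (b = 1)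
  xyBlock : ℕ → Bool → ℕ → Word
  xyBlock k b i = block (2 ^ (2 ^ k)) i (μ^ (2 ^ suc k) [ b ])

  csBlock : ℕ → ℕ → Word
  csBlock k i = if i % 2 ≡ᵇ 0 then xyBlock k false i
    else (if wordEq (xyBlock k false i) (xyBlock k true (suc i)) then xyBlock k false i else CS k)

  CS-suc : ∀ k → CS (suc k) ≡ concatMap (csBlock k) (upTo (2 ^ (2 ^ k) ∸ 1))
  CS-suc k = refl

  -- μ^{2^{k+1}} = μ^{2^k} ∘ μ^{2^k}, so block i of μ^{2^{k+1}}(b) is μ^{2^k}(b ⊕ t_i)
  xyBlock-block : ∀ k b i → i < 2 ^ (2 ^ k) → xyBlock k b i ≡ μ^ (2 ^ k) [ b xor t i ]
  xyBlock-block k b i i<L = begin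
      block L i (μ^ (2 ^ k + (2 ^ k + 0)) [ b ])
    ≡⟨ cong (λ n → block L i (μ^ (2 ^ k + n) [ b ])) (+-identityʳ (2 ^ k)) ⟩
      block L i (μ^ (2 ^ k + 2 ^ k) [ b ])
    ≡⟨ cong (block L i) (μ^-+ (2 ^ k) (2 ^ k) [ b ]) ⟩
      block L i (μ^ (2 ^ k) (μ^ (2 ^ k) [ b ]))
    ≡⟨ block-μ^-μ^ (2 ^ k) (2 ^ k) b i i<L ⟩
      μ^ (2 ^ k) [ b xor t i ] ∎
    where L = 2 ^ (2 ^ k)

  even-mod : ∀ j → j * 2 % 2 ≡ 0
  even-mod j = m*n%n≡0 j 2

  length-csBlock-even : ∀ k j → j * 2 < 2 ^ (2 ^ k) → length (csBlock k (j * 2)) ≡ 2 ^ (2 ^ k)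
  length-csBlock-even k j lt rewrite even-mod j | xyBlock-block k false (j * 2) lt =
    length-μ^-letter (2 ^ k) _

  wordEq-μ^-letters : ∀ n a b → wordEq (μ^ n [ a ]) (μ^ n [ b ]) ≡ does (a ≟ᵇ b)
  wordEq-μ^-letters n a b with a ≟ᵇ b
  ... | yes refl = dec-true (≡-dec _≟ᵇ_ (μ^ n [ a ]) (μ^ n [ a ])) refl
  ... | no a≢b = dec-false (≡-dec _≟ᵇ_ (μ^ n [ a ]) (μ^ n [ b ])) (λ e → a≢b (μ^-letter-injective n a b e))

  ≟ᵇ-not : ∀ a b → does (not a ≟ᵇ not b) ≡ does (a ≟ᵇ b)
  ≟ᵇ-not false false = refl
  ≟ᵇ-not false true = refl
  ≟ᵇ-not true false = refl
  ≟ᵇ-not true true = refl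

  -- x_{2j+1} = y_{2j+2} exactly when t_j = t_{j+1}; then cs_{2j+1} is a full block, otherwise CS(k)
  length-csBlock-odd : ∀ k j → suc j * 2 < 2 ^ (2 ^ k) →
    length (csBlock k (suc (j * 2))) ≡ (if repeatAt j then 2 ^ (2 ^ k) else length (CS k))
  length-csBlock-odd k j lt
    rewrite odd-mod j
          | xyBlock-block k false (suc (j * 2)) (<-trans (n<1+n _) lt)
          | xyBlock-block k true (suc (suc (j * 2))) lt
          | t-odd j
          | t-even (suc j)
          | wordEq-μ^-letters (2 ^ k) (not (t j)) (not (t (suc j)))
          | ≟ᵇ-not (t j) (t (suc j))
          with repeatAt j
  ... | true = length-μ^-letter (2 ^ k) _
  ... | false = refl

open BlocksOfCS using (repeatAt; csBlock; CS-suc; length-csBlock-even; length-csBlock-odd)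

module Sums where
  open import Data.Nat
  open import Data.Nat.Properties
    using (≤-refl; m<n⇒m<1+n; +-assoc; +-comm; +-identityʳ; *-identityʳ; *-distribʳ-+; +-commutativeSemigroup)
  open import Algebra.Properties.CommutativeSemigroup +-commutativeSemigroup using (interchange)
  open ≡-Reasoning

  sumTo : (ℕ → ℕ) → ℕ → ℕ
  sumTo g zero = 0
  sumTo g (suc n) = sumTo g n + g n

  count : (ℕ → Bool) → ℕ → ℕ
  count p = sumTo (λ j → if p j then 1 else 0)

  length-concatMap-upTo : ∀ {A : Set} (w : ℕ → List A) n →
    length (concatMap w (upTo n)) ≡ sumTo (λ i → length (w i)) n
  length-concatMap-upTo w zero = refl
  length-concatMap-upTo w (suc n) = begin
      length (concatMap w (upTo (suc n)))
    ≡⟨ cong (λ is → length (concatMap w is)) (sym (upTo-∷ʳ n)) ⟩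
      length (concatMap w (upTo n ++ [ n ]))
    ≡⟨ cong length (concatMap-++ w (upTo n) [ n ]) ⟩
      length (concatMap w (upTo n) ++ (w n ++ []))
    ≡⟨ length-++ (concatMap w (upTo n)) ⟩
      length (concatMap w (upTo n)) + length (w n ++ [])
    ≡⟨ cong₂ _+_ (length-concatMap-upTo w n) (cong length (++-identityʳ (w n))) ⟩
      sumTo (λ i → length (w i)) (suc n) ∎

  length-filter-singleton : ∀ {ℓ} {P : Pred ℕ ℓ} (P? : Decidable P) n →
    length (filter P? [ n ]) ≡ (if does (P? n) then 1 else 0)
  length-filter-singleton P? n with does (P? n)
  ... | true = refl
  ... | false = refl

  length-filter-upTo : ∀ {ℓ} {P : Pred ℕ ℓ} (P? : Decidable P) n →
    length (filter P? (upTo n)) ≡ count (λ i → does (P? i)) n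
  length-filter-upTo P? zero = refl
  length-filter-upTo P? (suc n) = begin
      length (filter P? (upTo (suc n)))
    ≡⟨ cong (λ is → length (filter P? is)) (sym (upTo-∷ʳ n)) ⟩
      length (filter P? (upTo n ++ [ n ]))
    ≡⟨ cong length (filter-++ P? (upTo n) [ n ]) ⟩
      length (filter P? (upTo n) ++ filter P? [ n ])
    ≡⟨ length-++ (filter P? (upTo n)) ⟩
      length (filter P? (upTo n)) + length (filter P? [ n ])
    ≡⟨ cong₂ _+_ (length-filter-upTo P? n) (length-filter-singleton P? n) ⟩
      count (λ i → does (P? i)) (suc n) ∎

  sumTo-cong : ∀ {g h : ℕ → ℕ} n → (∀ j → j < n → g j ≡ h j) → sumTo g n ≡ sumTo h n
  sumTo-cong zero _ = refl
  sumTo-cong (suc n) g≡h = cong₂ _+_ (sumTo-cong n (λ j j<n → g≡h j (m<n⇒m<1+n j<n))) (g≡h n ≤-refl)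

  sumTo-pairs : ∀ g n → sumTo g (n * 2) ≡ sumTo (λ j → g (j * 2) + g (suc (j * 2))) n
  sumTo-pairs g zero = refl
  sumTo-pairs g (suc n) = begin
      sumTo g (n * 2) + g (n * 2) + g (suc (n * 2))
    ≡⟨ +-assoc (sumTo g (n * 2)) _ _ ⟩
      sumTo g (n * 2) + (g (n * 2) + g (suc (n * 2)))
    ≡⟨ cong (_+ (g (n * 2) + g (suc (n * 2)))) (sumTo-pairs g n) ⟩
      sumTo (λ j → g (j * 2) + g (suc (j * 2))) (suc n) ∎

  sumTo-+ : ∀ g h n → sumTo (λ j → g j + h j) n ≡ sumTo g n + sumTo h n
  sumTo-+ g h zero = refl
  sumTo-+ g h (suc n) = begin
      sumTo (λ j → g j + h j) n + (g n + h n)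
    ≡⟨ cong (_+ (g n + h n)) (sumTo-+ g h n) ⟩
      sumTo g n + sumTo h n + (g n + h n)
    ≡⟨ interchange (sumTo g n) (sumTo h n) (g n) (h n) ⟩
      sumTo g n + g n + (sumTo h n + h n) ∎

  sumTo-const : ∀ a n → sumTo (λ _ → a) n ≡ n * a
  sumTo-const a zero = refl
  sumTo-const a (suc n) = trans (cong (_+ a) (sumTo-const a n)) (+-comm (n * a) a)

  sumTo-*ʳ : ∀ g c n → sumTo (λ j → g j * c) n ≡ sumTo g n * c
  sumTo-*ʳ g c zero = refl
  sumTo-*ʳ g c (suc n) = trans (cong (_+ g n * c) (sumTo-*ʳ g c n)) (sym (*-distribʳ-+ c (sumTo g n) (g n)))

  count-not : ∀ p n → count (λ j → not (p j)) n + count p n ≡ n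
  count-not p n = begin
      count (λ j → not (p j)) n + count p n
    ≡⟨ sumTo-+ _ _ n ⟨
      sumTo (λ j → (if not (p j) then 1 else 0) + (if p j then 1 else 0)) n
    ≡⟨ sumTo-cong n (λ j _ → exactly-one (p j)) ⟩
      sumTo (λ _ → 1) n
    ≡⟨ sumTo-const 1 n ⟩
      n * 1
    ≡⟨ *-identityʳ n ⟩
      n ∎
    where
    exactly-one : ∀ b → (if not b then 1 else 0) + (if b then 1 else 0) ≡ 1
    exactly-one true = refl
    exactly-one false = refl

  -- a sum whose terms are a (where p holds) or b (elsewhere), written without subtraction
  sumTo-choice : ∀ p a b n →
    sumTo (λ j → if p j then a else b) n + count p n * b ≡ count p n * a + n * b
  sumTo-choice p a b n = begin
      sumTo choice n + count p n * b
    ≡⟨ cong (sumTo choice n +_) (sumTo-*ʳ indicator b n) ⟨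
      sumTo choice n + sumTo (λ j → indicator j * b) n
    ≡⟨ sumTo-+ choice (λ j → indicator j * b) n ⟨
      sumTo (λ j → choice j + indicator j * b) n
    ≡⟨ sumTo-cong n (λ j _ → pointwise (p j)) ⟩
      sumTo (λ j → indicator j * a + b) n
    ≡⟨ sumTo-+ (λ j → indicator j * a) (λ _ → b) n ⟩
      sumTo (λ j → indicator j * a) n + sumTo (λ _ → b) n
    ≡⟨ cong₂ _+_ (sumTo-*ʳ indicator a n) (sumTo-const b n) ⟩
      count p n * a + n * b ∎
    where
    choice indicator : ℕ → ℕ
    choice j = if p j then a else b
    indicator j = if p j then 1 else 0
    pointwise : ∀ c → (if c then a else b) + (if c then 1 else 0) * b ≡ (if c then 1 else 0) * a + b
    pointwise true = trans (cong (a +_) (+-identityʳ b)) (cong (_+ b) (sym (+-identityʳ a)))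
    pointwise false = +-identityʳ b

open Sums using (sumTo; count; length-concatMap-upTo; length-filter-upTo; sumTo-cong; sumTo-pairs; sumTo-+; sumTo-const; count-not; sumTo-choice)

module PowersOfTwo where
  open import Data.Nat
  open import Data.Nat.Properties using (m∸n+n≡m; m^n>0; +-comm)
  open import Data.Nat.Tactic.RingSolver using (solve-∀)
  open ≡-Reasoning

  2^-pred : ∀ n → 2 ^ n ≡ suc (2 ^ n ∸ 1)
  2^-pred n = trans (sym (m∸n+n≡m (m^n>0 2 n))) (+-comm (2 ^ n ∸ 1) 1)

  2^suc-pred : ∀ n → 2 ^ suc n ∸ 1 ≡ suc ((2 ^ n ∸ 1) * 2)
  2^suc-pred n = begin
      2 * 2 ^ n ∸ 1
    ≡⟨ cong (λ x → 2 * x ∸ 1) (2^-pred n) ⟩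
      2 * suc J ∸ 1
    ≡⟨ cong (_∸ 1) (double-suc J) ⟩
      suc (J * 2) ∎
    where
    J = 2 ^ n ∸ 1
    double-suc : ∀ x → 2 * suc x ≡ 2 + x * 2
    double-suc = solve-∀

open PowersOfTwo using (2^-pred; 2^suc-pred)

module AdjacentEqualities where
  open import Data.Nat
  open import Data.Nat.Properties using (+-identityʳ; +-comm; +-cancelʳ-≡; m+n≡0⇒m≡0)
  open import Data.Nat.Tactic.RingSolver using (solve-∀)
  open ≡-Reasoning

  eq-count : ∀ n → eq n ≡ count repeatAt (2 ^ n ∸ 1)
  eq-count n = length-filter-upTo (λ i → t i ≟ᵇ t (suc i)) (2 ^ n ∸ 1)

  ≟ᵇ-not-self : ∀ b → does (b ≟ᵇ not b) ≡ false
  ≟ᵇ-not-self false = refl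
  ≟ᵇ-not-self true = refl

  not-≟ᵇ : ∀ a b → does (not a ≟ᵇ b) ≡ not (does (a ≟ᵇ b))
  not-≟ᵇ false false = refl
  not-≟ᵇ false true = refl
  not-≟ᵇ true false = refl
  not-≟ᵇ true true = refl

  repeatAt-even : ∀ j → repeatAt (j * 2) ≡ false
  repeatAt-even j rewrite t-even j | t-odd j = ≟ᵇ-not-self (t j)

  repeatAt-odd : ∀ j → repeatAt (suc (j * 2)) ≡ not (repeatAt j)
  repeatAt-odd j rewrite t-odd j | t-even (suc j) = not-≟ᵇ (t j) (t (suc j))

  count-repeatAt-odd : ∀ n → count repeatAt (suc (n * 2)) ≡ count (λ j → not (repeatAt j)) n
  count-repeatAt-odd n = begin
      count repeatAt (n * 2) + (if repeatAt (n * 2) then 1 else 0)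
    ≡⟨ cong (λ b → count repeatAt (n * 2) + (if b then 1 else 0)) (repeatAt-even n) ⟩
      count repeatAt (n * 2) + 0
    ≡⟨ +-identityʳ _ ⟩
      count repeatAt (n * 2)
    ≡⟨ sumTo-pairs _ n ⟩
      sumTo (λ j → (if repeatAt (j * 2) then 1 else 0) + (if repeatAt (suc (j * 2)) then 1 else 0)) n
    ≡⟨ sumTo-cong n (λ j _ → cong₂ (λ b c → (if b then 1 else 0) + (if c then 1 else 0))
                                   (repeatAt-even j) (repeatAt-odd j)) ⟩
      count (λ j → not (repeatAt j)) n ∎

  eq-recurrence : ∀ n → eq (suc n) + eq n + 1 ≡ 2 ^ n
  eq-recurrence n = begin
      eq (suc n) + eq n + 1
    ≡⟨ cong₂ (λ a b → a + b + 1) (trans (eq-count (suc n)) (cong (count repeatAt) (2^suc-pred n))) (eq-count n) ⟩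
      count repeatAt (suc (J * 2)) + count repeatAt J + 1
    ≡⟨ cong (λ a → a + count repeatAt J + 1) (count-repeatAt-odd J) ⟩
      count (λ j → not (repeatAt j)) J + count repeatAt J + 1
    ≡⟨ cong (_+ 1) (count-not repeatAt J) ⟩
      J + 1
    ≡⟨ +-comm J 1 ⟩
      suc J
    ≡⟨ 2^-pred n ⟨
      2 ^ n ∎
    where J = 2 ^ n ∸ 1

  cancel-step : ∀ a b x → a + x + 1 ≡ b + x + 1 → a ≡ b
  cancel-step a b x e = +-cancelʳ-≡ x a b (+-cancelʳ-≡ 1 (a + x) (b + x) e)

  odd-closed-form : (e : ℕ → ℕ) → (∀ n → e (suc n) + e n + 1 ≡ 2 ^ n) →
    ∀ p → 3 * e (suc (p * 2)) + 2 ≡ 2 ^ suc (p * 2)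
  odd-closed-form e rec zero =
    cong (λ x → 3 * x + 2) (m+n≡0⇒m≡0 (e 1) (+-cancelʳ-≡ 1 (e 1 + e 0) 0 (rec 0)))
  odd-closed-form e rec (suc p) = begin
      3 * e (suc (suc (suc (p * 2)))) + 2
    ≡⟨ cong (λ y → 3 * y + 2) next-odd ⟩
      3 * (4 * x + 2) + 2
    ≡⟨ scale x ⟩
      2 * (2 * (3 * x + 2))
    ≡⟨ cong (λ y → 2 * (2 * y)) (odd-closed-form e rec p) ⟩
      2 ^ suc (suc (suc (p * 2))) ∎
    where
    x = e (suc (p * 2))
    next-even : e (suc (suc (p * 2))) ≡ 2 * x + 1
    next-even = cancel-step _ _ x (begin
        e (suc (suc (p * 2))) + x + 1
      ≡⟨ rec (suc (p * 2)) ⟩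
        2 ^ suc (p * 2)
      ≡⟨ odd-closed-form e rec p ⟨
        3 * x + 2
      ≡⟨ split₁ x ⟩
        2 * x + 1 + x + 1 ∎)
      where
      split₁ : ∀ x → 3 * x + 2 ≡ 2 * x + 1 + x + 1
      split₁ = solve-∀
    next-odd : e (suc (suc (suc (p * 2)))) ≡ 4 * x + 2
    next-odd = cancel-step _ _ (e (suc (suc (p * 2)))) (begin
        e (suc (suc (suc (p * 2)))) + e (suc (suc (p * 2))) + 1
      ≡⟨ rec (suc (suc (p * 2))) ⟩
        2 * 2 ^ suc (p * 2)
      ≡⟨ cong (2 *_) (odd-closed-form e rec p) ⟨
        2 * (3 * x + 2)
      ≡⟨ split₂ x ⟩
        4 * x + 2 + (2 * x + 1) + 1
      ≡⟨ cong (λ y → 4 * x + 2 + y + 1) next-even ⟨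
        4 * x + 2 + e (suc (suc (p * 2))) + 1 ∎)
      where
      split₂ : ∀ x → 2 * (3 * x + 2) ≡ 4 * x + 2 + (2 * x + 1) + 1
      split₂ = solve-∀
    scale : ∀ x → 3 * (4 * x + 2) + 2 ≡ 2 * (2 * (3 * x + 2))
    scale = solve-∀

  eq-odd : ∀ p → 3 * eq (suc (p * 2)) + 2 ≡ 2 ^ suc (p * 2)
  eq-odd = odd-closed-form eq eq-recurrence

  -- 2^{k+1} - 1 is odd, so eq(2^{k+1} - 1) = (2^{2^{k+1}-1} - 2)/3
  eq-odd-power : ∀ k → 3 * eq (2 ^ suc k ∸ 1) + 2 ≡ 2 ^ (2 ^ suc k ∸ 1)
  eq-odd-power k = subst (λ n → 3 * eq n + 2 ≡ 2 ^ n) (sym (2^suc-pred k)) (eq-odd (2 ^ k ∸ 1))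

open AdjacentEqualities using (eq-count; eq-odd-power)

module LengthOfCS (k : ℕ) where
  open import Data.Nat
  open import Data.Nat.Properties using (*-comm; <-trans; n<1+n; m<n⇒m<1+n; *-monoˡ-<; +-identityʳ; ^-distribˡ-+-*)
  open ≡-Reasoning

  L J C : ℕ
  L = 2 ^ (2 ^ k)
  J = 2 ^ (2 ^ k ∸ 1) ∸ 1
  C = length (CS k)

  oddLength : ℕ → ℕ
  oddLength j = if repeatAt j then L else C

  L≡ : L ≡ suc J * 2
  L≡ = begin
      2 ^ (2 ^ k)
    ≡⟨ cong (2 ^_) (2^-pred k) ⟩
      2 * 2 ^ (2 ^ k ∸ 1)
    ≡⟨ cong (2 *_) (2^-pred (2 ^ k ∸ 1)) ⟩
      2 * suc J
    ≡⟨ *-comm 2 (suc J) ⟩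
      suc J * 2 ∎

  L²≡ : 2 ^ (2 ^ suc k) ≡ L * L
  L²≡ = trans (cong (λ n → 2 ^ (2 ^ k + n)) (+-identityʳ (2 ^ k))) (^-distribˡ-+-* 2 (2 ^ k) (2 ^ k))

  block-count : L ∸ 1 ≡ suc (J * 2)
  block-count = trans (cong (λ n → 2 ^ n ∸ 1) (2^-pred k)) (2^suc-pred (2 ^ k ∸ 1))

  odd-bound : ∀ {j} → j < J → suc j * 2 < L
  odd-bound j<J rewrite L≡ = *-monoˡ-< 2 (s≤s j<J)

  even-bound : ∀ {j} → j < J → j * 2 < L
  even-bound {j} j<J = <-trans (m<n⇒m<1+n (n<1+n (j * 2))) (odd-bound j<J)

  last-bound : J * 2 < L
  last-bound rewrite L≡ = *-monoˡ-< 2 (n<1+n J)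

  -- |CS(k+1)| = (J+1)·L (even blocks) + Σ_{j<J} |cs_{2j+1}| (odd blocks)
  length-CS-suc : length (CS (suc k)) ≡ J * L + sumTo oddLength J + L
  length-CS-suc = begin
      length (CS (suc k))
    ≡⟨ cong length (CS-suc k) ⟩
      length (concatMap (csBlock k) (upTo (L ∸ 1)))
    ≡⟨ length-concatMap-upTo (csBlock k) (L ∸ 1) ⟩
      sumTo ℓ (L ∸ 1)
    ≡⟨ cong (sumTo ℓ) block-count ⟩
      sumTo ℓ (J * 2) + ℓ (J * 2)
    ≡⟨ cong₂ _+_ (sumTo-pairs ℓ J) (length-csBlock-even k J last-bound) ⟩
      sumTo (λ j → ℓ (j * 2) + ℓ (suc (j * 2))) J + L
    ≡⟨ cong (_+ L) (sumTo-cong J (λ j j<J → cong₂ _+_ (length-csBlock-even k j (even-bound j<J))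
                                                      (length-csBlock-odd k j (odd-bound j<J)))) ⟩
      sumTo (λ j → L + oddLength j) J + L
    ≡⟨ cong (_+ L) (trans (sumTo-+ (λ _ → L) oddLength J) (cong (_+ sumTo oddLength J) (sumTo-const L J))) ⟩
      J * L + sumTo oddLength J + L ∎
    where
    ℓ : ℕ → ℕ
    ℓ i = length (csBlock k i)

  -- the odd blocks: T = eq(2^k - 1) of them are full, the other J - T are copies of CS(k)
  length-odd-blocks : sumTo oddLength J + eq (2 ^ k ∸ 1) * C ≡ eq (2 ^ k ∸ 1) * L + J * C
  length-odd-blocks rewrite eq-count (2 ^ k ∸ 1) = sumTo-choice repeatAt L C J

module IntegerRecurrence where
  open import Data.Integer using (ℤ; +_; _+_; _*_; _-_)
  open import Data.Integer.Properties using (pos-*)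
  open import Data.Integer.Tactic.RingSolver using (solve-∀)
  open ≡-Reasoning

  recurrence-algebra : ∀ (J T S C L : ℤ) → L ≡ (+ 1 + J) * + 2 → S + T * C ≡ T * L + J * C →
    L * L - (J * L + S + L) ≡ L + (+ 1 + J - + 1 - T) * (L - C)
  recurrence-algebra J T S C L refl odd = begin
      L * L - (J * L + S + L)
    ≡⟨ cong (λ s → L * L - (J * L + s + L)) (trans (isolate S (T * C)) (cong (_- T * C) odd)) ⟩
      L * L - (J * L + (T * L + J * C - T * C) + L)
    ≡⟨ identity J T C ⟩
      L + (+ 1 + J - + 1 - T) * (L - C) ∎
    where
    isolate : ∀ s x → s ≡ s + x - x
    isolate = solve-∀
    identity : ∀ J T C → let L = (+ 1 + J) * + 2 in
      L * L - (J * L + (T * L + J * C - T * C) + L) ≡ L + (+ 1 + J - + 1 - T) * (L - C)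
    identity = solve-∀

  f-recurrence : ∀ k → f (suc k) ≡ + (2 ^ (2 ^ k)) + (+ (2 ^ (2 ^ k ∸ 1)) - + 1 - + eq (2 ^ k ∸ 1)) * f k
  f-recurrence k = begin
      + (2 ^ (2 ^ suc k)) - + length (CS (suc k))
    ≡⟨ cong₂ _-_ (trans (cong +_ L²≡) (pos-* L L))
                 (trans (cong +_ length-CS-suc) (cong (λ x → x + + S + + L) (pos-* J L))) ⟩
      + L * + L - (+ J * + L + + S + + L)
    ≡⟨ recurrence-algebra (+ J) (+ T) (+ S) (+ C) (+ L) (trans (cong +_ L≡) (pos-* (suc J) 2)) odd-blocks ⟩
      + L + (+ suc J - + 1 - + T) * (+ L - + C)
    ≡⟨ cong (λ h → + L + (+ h - + 1 - + T) * f k) (sym (2^-pred (2 ^ k ∸ 1))) ⟩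
      + L + (+ (2 ^ (2 ^ k ∸ 1)) - + 1 - + T) * f k ∎
    where
    open LengthOfCS k
    T S : ℕ
    T = eq (2 ^ k ∸ 1)
    S = sumTo oddLength J
    odd-blocks : + S + + T * + C ≡ + T * + L + + J * + C
    odd-blocks = trans (cong (λ x → + S + x) (sym (pos-* T C)))
      (trans (cong +_ length-odd-blocks) (cong₂ _+_ (pos-* T L) (pos-* J C)))

  eq-odd-powerℤ : ∀ k → + (2 ^ (2 ^ suc k ∸ 1)) ≡ + 3 * + eq (2 ^ suc k ∸ 1) + + 2
  eq-odd-powerℤ k = trans (cong +_ (sym (eq-odd-power k))) (cong (_+ + 2) (pos-* 3 (eq (2 ^ suc k ∸ 1))))

open IntegerRecurrence using (f-recurrence; eq-odd-powerℤ)

module RationalForm where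
  open import Data.Integer using (ℤ; +_; _+_; _*_; _-_; -_)
  open import Data.Integer.Tactic.RingSolver using (solve-∀)
  open import Data.Rational as ℚ using (ℚ; toℚᵘ)
  open import Data.Rational.Properties using (toℚᵘ-injective; toℚᵘ-fromℚᵘ; toℚᵘ-homo-+; toℚᵘ-homo-*; toℚᵘ-homo‿-; *-assoc; *-identityˡ)
  open import Data.Rational.Unnormalised as ℚᵘ using (mkℚᵘ; *≡*)
  import Data.Rational.Unnormalised.Properties as ℚᵘ

  -- the embedding i ↦ i/1 of ℤ into ℚ; it is a ring homomorphism, checked on unnormalised rationals
  ι : ℤ → ℚ
  ι i = i ℚ./ 1

  toℚᵘ-ι : ∀ i → toℚᵘ (ι i) ℚᵘ.≃ mkℚᵘ i 0
  toℚᵘ-ι i = toℚᵘ-fromℚᵘ (mkℚᵘ i 0)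

  ι-+ : ∀ a b → ι (a + b) ≡ ι a ℚ.+ ι b
  ι-+ a b = toℚᵘ-injective (begin
      toℚᵘ (ι (a + b))                 ≈⟨ toℚᵘ-ι (a + b) ⟩
      mkℚᵘ (a + b) 0                   ≈⟨ *≡* (denominators-one a b) ⟩
      mkℚᵘ a 0 ℚᵘ.+ mkℚᵘ b 0           ≈⟨ ℚᵘ.+-cong (toℚᵘ-ι a) (toℚᵘ-ι b) ⟨
      toℚᵘ (ι a) ℚᵘ.+ toℚᵘ (ι b)       ≈⟨ toℚᵘ-homo-+ (ι a) (ι b) ⟨
      toℚᵘ (ι a ℚ.+ ι b)               ∎)
    where
    open ℚᵘ.≃-Reasoning
    denominators-one : ∀ a b → (a + b) * + 1 ≡ (a * + 1 + b * + 1) * + 1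
    denominators-one = solve-∀

  ι-* : ∀ a b → ι (a * b) ≡ ι a ℚ.* ι b
  ι-* a b = toℚᵘ-injective (begin
      toℚᵘ (ι (a * b))                 ≈⟨ toℚᵘ-ι (a * b) ⟩
      mkℚᵘ a 0 ℚᵘ.* mkℚᵘ b 0           ≈⟨ ℚᵘ.*-cong (toℚᵘ-ι a) (toℚᵘ-ι b) ⟨
      toℚᵘ (ι a) ℚᵘ.* toℚᵘ (ι b)       ≈⟨ toℚᵘ-homo-* (ι a) (ι b) ⟨
      toℚᵘ (ι a ℚ.* ι b)               ∎)
    where open ℚᵘ.≃-Reasoning

  ι-neg : ∀ a → ι (- a) ≡ ℚ.- ι a
  ι-neg a = toℚᵘ-injective (begin
      toℚᵘ (ι (- a))                   ≈⟨ toℚᵘ-ι (- a) ⟩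
      ℚᵘ.- mkℚᵘ a 0                    ≈⟨ ℚᵘ.-‿cong (toℚᵘ-ι a) ⟨
      ℚᵘ.- toℚᵘ (ι a)                  ≈⟨ toℚᵘ-homo‿- (ι a) ⟨
      toℚᵘ (ℚ.- ι a)                   ∎)
    where open ℚᵘ.≃-Reasoning

  ι-- : ∀ a b → ι (a - b) ≡ ι a ℚ.- ι b
  ι-- a b = trans (ι-+ a (- b)) (cong (ι a ℚ.+_) (ι-neg b))

  -- if H = 3E + 2 then E = (H - 2)/3, so the integer form of the recurrence has this rational form
  rational-form : ∀ (A H E F : ℤ) → H ≡ + 3 * E + + 2 →
    ι (A + (H - + 1 - E) * F) ≡ ι A ℚ.+ (ι (H - + 1) ℚ.- (+ 1 ℚ./ 3) ℚ.* ι (H - + 2)) ℚ.* ι F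
  rational-form A H E F H≡ = begin
      ι (A + (H - + 1 - E) * F)
    ≡⟨ ι-+ A _ ⟩
      ι A ℚ.+ ι ((H - + 1 - E) * F)
    ≡⟨ cong (ι A ℚ.+_) (trans (ι-* (H - + 1 - E) F) (cong (ℚ._* ι F) (ι-- (H - + 1) E))) ⟩
      ι A ℚ.+ (ι (H - + 1) ℚ.- ι E) ℚ.* ι F
    ≡⟨ cong (λ q → ι A ℚ.+ (ι (H - + 1) ℚ.- q) ℚ.* ι F) third ⟨
      ι A ℚ.+ (ι (H - + 1) ℚ.- (+ 1 ℚ./ 3) ℚ.* ι (H - + 2)) ℚ.* ι F ∎
    where
    open ≡-Reasoning
    H-2≡ : H - + 2 ≡ + 3 * E
    H-2≡ = trans (cong (_- + 2) H≡) (cancel-two E)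
      where
      cancel-two : ∀ E → + 3 * E + + 2 - + 2 ≡ + 3 * E
      cancel-two = solve-∀
    third : (+ 1 ℚ./ 3) ℚ.* ι (H - + 2) ≡ ι E
    third = begin
        (+ 1 ℚ./ 3) ℚ.* ι (H - + 2)
      ≡⟨ cong (λ x → (+ 1 ℚ./ 3) ℚ.* ι x) H-2≡ ⟩
        (+ 1 ℚ./ 3) ℚ.* ι (+ 3 * E)
      ≡⟨ cong ((+ 1 ℚ./ 3) ℚ.*_) (ι-* (+ 3) E) ⟩
        (+ 1 ℚ./ 3) ℚ.* (ι (+ 3) ℚ.* ι E)
      ≡⟨ *-assoc (+ 1 ℚ./ 3) (ι (+ 3)) (ι E) ⟨
        ((+ 1 ℚ./ 3) ℚ.* ι (+ 3)) ℚ.* ι E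
      ≡⟨ *-identityˡ (ι E) ⟩
        ι E ∎

open RationalForm using (rational-form)

open import Data.Integer using (ℤ; +_; _+_; _*_; _-_)
open import Data.Product using (_×_; _,_)
import Data.Rational as ℚ

lemma6 : (k : ℕ) → k ≥ 1 →
  (f (suc k) ≡ + (2 ^ (2 ^ k)) + (+ (2 ^ (2 ^ k ∸ 1)) - + 1 - + eq (2 ^ k ∸ 1)) * f k)
  × (((f (suc k)) ℚ./ 1)
      ≡ ((+ (2 ^ (2 ^ k))) ℚ./ 1)
        ℚ.+ (((+ (2 ^ (2 ^ k ∸ 1)) - + 1) ℚ./ 1)
             ℚ.- (+ 1 ℚ./ 3) ℚ.* ((+ (2 ^ (2 ^ k ∸ 1)) - + 2) ℚ./ 1))
            ℚ.* ((f k) ℚ./ 1))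
lemma6 zero ()
lemma6 (suc k) _ =
  f-recurrence (suc k) ,
  trans (cong (ℚ._/ 1) (f-recurrence (suc k))) (rational-form L H E (f (suc k)) (eq-odd-powerℤ k))
  where
  L H E : ℤ
  L = + (2 ^ (2 ^ suc k))
  H = + (2 ^ (2 ^ suc k ∸ 1))
  E = + eq (2 ^ suc k ∸ 1)
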